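{- Let $q\geq 3$ be an integer. For every positive integer $m$ there exist explicitly computable constants $d>0$, $e_1$, $e_2$, depending only on $m$ and $q$, such that the following holds. Let $k,n$ be positive integers with $k>2m(m+1)-1$ and $n>(m+1)k+d$, and let $u$ be the natural number whose base-$q$ expansion is \[ (u)_q=(q-1)^{(k)}\,(q-2)\,(q-1)^{(k+1)}\,(q-2)\,(q-1)^{(k+2)}\cdots(q-2)\,(q-1)^{(k+m)}\,(q-2)\,(q-1)^{(n)}. \] Then $s_q(u^2)=(q-1)(n-mk)+e_1$ and $s_q(u)=(q-1)(k(m+1)+n)+e_2$.
   Context: $s_q(n)$ denotes the sum of the digits of $n$ in base $q$. In a digit string, $x^{(a)}$ denotes the digit $x$ repeated $a$ times consecutively; the string is read from the most significant digit to the least significant. -}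

module Defs where

open import Data.Nat using (ℕ; zero; suc; _+_; _*_; _∸_)
open import Data.Nat.DivMod using (_/_; _%_)
open import Data.List using (List; []; _∷_; _++_; replicate; concat; map; upTo; foldl)

-- Digit sum with an explicit fuel bound (fuel n suffices for base ≥ 2).
digitSumAux : (fuel : ℕ) → (p : ℕ) → ℕ → ℕ
digitSumAux zero    p n = 0
digitSumAux (suc f) p n = n % suc p + digitSumAux f p (n / suc p)

s : (q : ℕ) → ℕ → ℕ
s zero    n = 0
s (suc p) n = digitSumAux n p n

fromDigitsMSB : (q : ℕ) → List ℕ → ℕ
fromDigitsMSB q = foldl (λ acc d → acc * q + d) 0

-- (q-1)^(k) (q-2) (q-1)^(k+1) (q-2) ... (q-1)^(k+m) (q-2) (q-1)^(n)
uDigits : (q m k n : ℕ) → List ℕ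
uDigits q m k n =
  concat (map (λ i → replicate (k + i) (q ∸ 1) ++ (q ∸ 2) ∷ []) (upTo (suc m)))
  ++ replicate n (q ∸ 1)

u : (q m k n : ℕ) → ℕ
u q m k n = fromDigitsMSB q (uDigits q m k n)

module Submission where

-- Let Q = q and x = Q^k.  Let A have digits 0^(k) 1 0^(k+1) 1 ... 0^(k+m) 1; its digits 1
-- sit at positions k·j + c_j with offsets c_j independent of k, so A = Σ_{j≤m} Q^(c_j) x^j.
-- Complementing digits gives u + 1 = Y·N with Y = W - A, W = Q^L (L the length of the
-- block part) and N = Q^n.  Hence u² = (Y² - 1)·N² + (N - 2Y)·N + 1 with non-overlapping
-- parts: N - 2Y has the digits (q-1)^(n-L-1) (q-2) followed by those of 2A, and expanding
-- A² gives Y² - 1 = x·(Σ_{t<2m} low_t x^t + x^(2m)·Q^(2c_m+1)·(Q·x - 2)) whose coefficients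
-- low_t are < Q^(2c_m) ≤ x as soon as k ≥ 2m(m+1).  Only the strings of digits q - 1
-- depend on k and n, which yields the two affine formulas.

open import Data.Nat using (ℕ)

module FiniteSums where

  open import Data.Nat
  open import Data.Nat.Properties
  open import Data.Nat.Tactic.RingSolver using (solve-∀)
  open import Data.Sum using (inj₁; inj₂)
  open import Relation.Nullary using (yes; no)
  open import Relation.Binary.PropositionalEquality

  sumTo : ℕ → (ℕ → ℕ) → ℕ
  sumTo zero    g = 0
  sumTo (suc n) g = sumTo n g + g n

  sumTo-cong : ∀ n (g h : ℕ → ℕ) → (∀ i → i < n → g i ≡ h i) → sumTo n g ≡ sumTo n h
  sumTo-cong zero    g h eq = refl
  sumTo-cong (suc n) g h eq =
    cong₂ _+_ (sumTo-cong n g h (λ i i<n → eq i (m<n⇒m<1+n i<n))) (eq n ≤-refl)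

  sumTo-zero : ∀ n (g : ℕ → ℕ) → (∀ i → i < n → g i ≡ 0) → sumTo n g ≡ 0
  sumTo-zero zero    g z = refl
  sumTo-zero (suc n) g z = cong₂ _+_ (sumTo-zero n g (λ i i<n → z i (m<n⇒m<1+n i<n))) (z n ≤-refl)

  sumTo-+ : ∀ n (g h : ℕ → ℕ) → sumTo n (λ i → g i + h i) ≡ sumTo n g + sumTo n h
  sumTo-+ zero    g h = refl
  sumTo-+ (suc n) g h = begin
    sumTo n (λ i → g i + h i) + (g n + h n)  ≡⟨ cong (_+ (g n + h n)) (sumTo-+ n g h) ⟩
    sumTo n g + sumTo n h + (g n + h n)      ≡⟨ interchange (sumTo n g) (sumTo n h) (g n) (h n) ⟩
    sumTo n g + g n + (sumTo n h + h n)      ∎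
    where
    open ≡-Reasoning
    interchange : ∀ a b c d → a + b + (c + d) ≡ a + c + (b + d)
    interchange = solve-∀

  sumTo-*ʳ : ∀ n (g : ℕ → ℕ) a → sumTo n g * a ≡ sumTo n (λ i → g i * a)
  sumTo-*ʳ zero    g a = refl
  sumTo-*ʳ (suc n) g a = trans (*-distribʳ-+ a (sumTo n g) (g n)) (cong (_+ g n * a) (sumTo-*ʳ n g a))

  sumTo-split : ∀ a b (g : ℕ → ℕ) → sumTo (a + b) g ≡ sumTo a g + sumTo b (λ j → g (a + j))
  sumTo-split a zero    g = trans (cong (λ z → sumTo z g) (+-identityʳ a)) (sym (+-identityʳ _))
  sumTo-split a (suc b) g = begin
    sumTo (a + suc b) g                                 ≡⟨ cong (λ z → sumTo z g) (+-suc a b) ⟩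
    sumTo (a + b) g + g (a + b)                         ≡⟨ cong (_+ g (a + b)) (sumTo-split a b g) ⟩
    sumTo a g + sumTo b (λ j → g (a + j)) + g (a + b)  ≡⟨ +-assoc (sumTo a g) _ _ ⟩
    sumTo a g + (sumTo b (λ j → g (a + j)) + g (a + b)) ∎
    where open ≡-Reasoning

  sumTo-mono : ∀ n (g h : ℕ → ℕ) → (∀ i → i < n → g i ≤ h i) → sumTo n g ≤ sumTo n h
  sumTo-mono zero    g h le = z≤n
  sumTo-mono (suc n) g h le =
    +-mono-≤ (sumTo-mono n g h (λ i i<n → le i (m<n⇒m<1+n i<n))) (le n ≤-refl)

  sumTo-monoˡ : ∀ {n n'} (g : ℕ → ℕ) → n ≤ n' → sumTo n g ≤ sumTo n' g
  sumTo-monoˡ {n} {n'} g n≤n' = subst (λ z → sumTo n g ≤ sumTo z g) (m+[n∸m]≡n n≤n')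
    (subst (sumTo n g ≤_) (sym (sumTo-split n (n' ∸ n) g)) (m≤m+n _ _))

  term≤sumTo : ∀ n (g : ℕ → ℕ) i → i < n → g i ≤ sumTo n g
  term≤sumTo (suc n) g i (s≤s i≤n) with m≤n⇒m<n∨m≡n i≤n
  ... | inj₁ i<n  = ≤-trans (term≤sumTo n g i i<n) (m≤m+n _ _)
  ... | inj₂ refl = m≤n+m _ _

  twoTerms≤sumTo : ∀ n (g : ℕ → ℕ) i j → i < j → j < n → g i + g j ≤ sumTo n g
  twoTerms≤sumTo (suc n) g i j i<j (s≤s j≤n) with m≤n⇒m<n∨m≡n j≤n
  ... | inj₁ j<n  = ≤-trans (twoTerms≤sumTo n g i j i<j j<n) (m≤m+n _ _)
  ... | inj₂ refl = +-monoˡ-≤ (g n) (term≤sumTo n g i i<j)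

  eval : ℕ → (ℕ → ℕ) → ℕ → ℕ
  eval n g x = sumTo n (λ i → g i * x ^ i)

  eval-support : ∀ m (g : ℕ → ℕ) x → (∀ i → m < i → g i ≡ 0) → ∀ d → eval (suc m + d) g x ≡ eval (suc m) g x
  eval-support m g x vanish d = begin
    eval (suc m + d) g x                                        ≡⟨ sumTo-split (suc m) d _ ⟩
    eval (suc m) g x + sumTo d (λ j → g (suc m + j) * x ^ (suc m + j))
      ≡⟨ cong (eval (suc m) g x +_) (sumTo-zero d _ (λ j _ → cong (_* x ^ (suc m + j)) (vanish (suc m + j) (s≤s (m≤m+n m j))))) ⟩
    eval (suc m) g x + 0                                        ≡⟨ +-identityʳ _ ⟩
    eval (suc m) g x                                            ∎
    where open ≡-Reasoning

  conv : (ℕ → ℕ) → (ℕ → ℕ) → ℕ → ℕ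
  conv g h s = sumTo (suc s) (λ i → g i * h (s ∸ i))

  cauchy-step : ∀ N i (g h : ℕ → ℕ) x → i ≤ N →
    g i * x ^ i * eval (N ∸ i) h x + g i * h (N ∸ i) * x ^ N ≡ g i * x ^ i * eval (suc N ∸ i) h x
  cauchy-step N i g h x i≤N = begin
    g i * x ^ i * eval (N ∸ i) h x + g i * h (N ∸ i) * x ^ N
      ≡⟨ cong (λ z → g i * x ^ i * eval (N ∸ i) h x + g i * h (N ∸ i) * x ^ z) (sym (m+[n∸m]≡n i≤N)) ⟩
    g i * x ^ i * eval (N ∸ i) h x + g i * h (N ∸ i) * x ^ (i + (N ∸ i))
      ≡⟨ cong (λ z → g i * x ^ i * eval (N ∸ i) h x + g i * h (N ∸ i) * z) (^-distribˡ-+-* x i (N ∸ i)) ⟩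
    g i * x ^ i * eval (N ∸ i) h x + g i * h (N ∸ i) * (x ^ i * x ^ (N ∸ i))
      ≡⟨ factor (g i) (x ^ i) (eval (N ∸ i) h x) (h (N ∸ i)) (x ^ (N ∸ i)) ⟩
    g i * x ^ i * eval (suc (N ∸ i)) h x
      ≡⟨ cong (λ z → g i * x ^ i * eval z h x) (sym (+-∸-assoc 1 i≤N)) ⟩
    g i * x ^ i * eval (suc N ∸ i) h x ∎
    where
    open ≡-Reasoning
    factor : ∀ a b c d e → a * b * c + a * d * (b * e) ≡ a * b * (c + d * e)
    factor = solve-∀

  eval-conv : ∀ N (g h : ℕ → ℕ) x → eval N (conv g h) x ≡ sumTo N (λ i → g i * x ^ i * eval (N ∸ i) h x)
  eval-conv zero    g h x = refl
  eval-conv (suc N) g h x = begin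
    eval N (conv g h) x + conv g h N * x ^ N
      ≡⟨ cong (_+ conv g h N * x ^ N) (eval-conv N g h x) ⟩
    sumTo N a + conv g h N * x ^ N
      ≡⟨ cong (_+ conv g h N * x ^ N) (sym (trans (cong (sumTo N a +_) lastTerm) (+-identityʳ _))) ⟩
    sumTo (suc N) a + conv g h N * x ^ N
      ≡⟨ cong (sumTo (suc N) a +_) (sumTo-*ʳ (suc N) (λ i → g i * h (N ∸ i)) (x ^ N)) ⟩
    sumTo (suc N) a + sumTo (suc N) (λ i → g i * h (N ∸ i) * x ^ N)
      ≡⟨ sym (sumTo-+ (suc N) a _) ⟩
    sumTo (suc N) (λ i → a i + g i * h (N ∸ i) * x ^ N)
      ≡⟨ sumTo-cong (suc N) _ _ (λ i i≤N → cauchy-step N i g h x (≤-pred i≤N)) ⟩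
    sumTo (suc N) (λ i → g i * x ^ i * eval (suc N ∸ i) h x) ∎
    where
    open ≡-Reasoning
    a : ℕ → ℕ
    a i = g i * x ^ i * eval (N ∸ i) h x
    lastTerm : a N ≡ 0
    lastTerm = trans (cong (λ z → g N * x ^ N * eval z h x) (n∸n≡0 N)) (*-zeroʳ (g N * x ^ N))

  eval-square : ∀ m (g : ℕ → ℕ) x → (∀ i → m < i → g i ≡ 0) →
    eval (suc (m + m)) (conv g g) x ≡ eval (suc m) g x * eval (suc m) g x
  eval-square m g x vanish = begin
    eval (suc (m + m)) (conv g g) x                                   ≡⟨ eval-conv (suc (m + m)) g g x ⟩
    sumTo (suc (m + m)) (λ i → g i * x ^ i * eval (suc (m + m) ∸ i) g x) ≡⟨ sumTo-cong (suc (m + m)) _ _ full ⟩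
    sumTo (suc (m + m)) (λ i → g i * x ^ i * G)                      ≡⟨ sym (sumTo-*ʳ (suc (m + m)) (λ i → g i * x ^ i) G) ⟩
    eval (suc m + m) g x * G                                           ≡⟨ cong (_* G) (eval-support m g x vanish m) ⟩
    G * G ∎
    where
    open ≡-Reasoning
    G : ℕ
    G = eval (suc m) g x
    full : ∀ i → i < suc (m + m) → g i * x ^ i * eval (suc (m + m) ∸ i) g x ≡ g i * x ^ i * G
    full i _ with i ≤? m
    ... | yes i≤m = cong (g i * x ^ i *_)
      (trans (cong (λ w → eval w g x) (+-∸-assoc (suc m) i≤m)) (eval-support m g x vanish (m ∸ i)))
    ... | no i≰m rewrite vanish i (≰⇒> i≰m) = refl

  eval< : ∀ n (g : ℕ → ℕ) x → (∀ i → i < n → g i < x) → eval n g x < x ^ n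
  eval< zero    g x _     = s≤s z≤n
  eval< (suc n) g x small = begin-strict
    eval n g x + g n * x ^ n  <⟨ +-monoˡ-< (g n * x ^ n) (eval< n g x (λ i i<n → small i (m<n⇒m<1+n i<n))) ⟩
    x ^ n + g n * x ^ n       ≤⟨ *-monoˡ-≤ (x ^ n) (small n ≤-refl) ⟩
    x * x ^ n ∎
    where open ≤-Reasoning

module Digits (b : ℕ) where

  open import Defs using (s; digitSumAux; fromDigitsMSB)
  open import Data.Nat
  open import Data.Nat.Properties
  open import Data.Nat.DivMod
  open import Data.Nat.Tactic.RingSolver using (solve-∀)
  open import Data.List using (List; []; _∷_; _++_; foldl; length)
  open import Data.List.Properties using (foldl-++)
  open import Data.Nat.ListAction using (sum)
  open import Data.List.Relation.Unary.All using (All; []; _∷_)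
  open import Data.List.Relation.Binary.Pointwise using (Pointwise; []; _∷_; Pointwise-length)
  open import Relation.Binary.PropositionalEquality
  open FiniteSums using (sumTo; eval; eval<)

  Q : ℕ
  Q = suc (suc b)

  Q-1<Q : suc b < Q
  Q-1<Q = ≤-refl

  Q-2<Q : b < Q
  Q-2<Q = m<n⇒m<1+n (n<1+n b)

  digitSum : ℕ → ℕ
  digitSum = s Q

  private
    1<Q : 1 < Q
    1<Q = s≤s (s≤s z≤n)

    aux-zero : ∀ f → digitSumAux f (suc b) 0 ≡ 0
    aux-zero zero    = refl
    aux-zero (suc f) = aux-zero f

    quot≤ : ∀ n f → n ≤ suc f → n / Q ≤ f
    quot≤ zero    f _  = z≤n
    quot≤ (suc n) f le = ≤-pred (≤-trans (m/n<m (suc n) Q 1<Q) le)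

    aux-fuel : ∀ f g n → n ≤ f → n ≤ g → digitSumAux f (suc b) n ≡ digitSumAux g (suc b) n
    aux-fuel zero    g       .zero z≤n _   = sym (aux-zero g)
    aux-fuel (suc f) zero    .zero _   z≤n = aux-zero (suc f)
    aux-fuel (suc f) (suc g) n     nf  ng  = cong (n % Q +_) (aux-fuel f g (n / Q) (quot≤ n f nf) (quot≤ n g ng))

  digitSum-step : ∀ n → digitSum n ≡ n % Q + digitSum (n / Q)
  digitSum-step zero    = refl
  digitSum-step (suc n) = cong (suc n % Q +_) (aux-fuel n (suc n / Q) (suc n / Q) (quot≤ (suc n) n ≤-refl) ≤-refl)

  digitSum-digit : ∀ a d → d < Q → digitSum (d + a * Q) ≡ d + digitSum a
  digitSum-digit a d d<Q = trans (digitSum-step (d + a * Q)) (cong₂ _+_ rem≡ (cong digitSum quot≡))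
    where
    rem≡ : (d + a * Q) % Q ≡ d
    rem≡ = trans ([m+kn]%n≡m%n d a Q) (m<n⇒m%n≡m d<Q)
    quot≡ : (d + a * Q) / Q ≡ a
    quot≡ = sym (*-cancelʳ-≡ a _ Q (+-cancelˡ-≡ d _ _
      (trans (m≡m%n+[m/n]*n (d + a * Q) Q) (cong (_+ (d + a * Q) / Q * Q) rem≡))))

  digitSum-concat : ∀ t a c → c < Q ^ t → digitSum (a * Q ^ t + c) ≡ digitSum a + digitSum c
  digitSum-concat zero a zero _ = trans (cong digitSum (trans (+-identityʳ _) (*-identityʳ a))) (sym (+-identityʳ _))
  digitSum-concat zero a (suc c) (s≤s ())
  digitSum-concat (suc t) a c c< = begin
    digitSum (a * Q ^ suc t + c)                      ≡⟨ cong digitSum shiftDigit ⟩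
    digitSum (c % Q + (a * Q ^ t + c / Q) * Q)        ≡⟨ digitSum-digit (a * Q ^ t + c / Q) (c % Q) (m%n<n c Q) ⟩
    c % Q + digitSum (a * Q ^ t + c / Q)              ≡⟨ cong (c % Q +_) (digitSum-concat t a (c / Q) c/Q<) ⟩
    c % Q + (digitSum a + digitSum (c / Q))           ≡⟨ swap (c % Q) (digitSum a) _ ⟩
    digitSum a + (c % Q + digitSum (c / Q))           ≡⟨ cong (digitSum a +_) (sym (digitSum-step c)) ⟩
    digitSum a + digitSum c ∎
    where
    open ≡-Reasoning
    c/Q< : c / Q < Q ^ t
    c/Q< = m<n*o⇒m/o<n (subst (c <_) (*-comm Q (Q ^ t)) c<)
    swap : ∀ x y z → x + (y + z) ≡ y + (x + z)
    swap = solve-∀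
    regroup : ∀ a w x y q → a * (q * w) + (x + y * q) ≡ x + (a * w + y) * q
    regroup = solve-∀
    shiftDigit : a * Q ^ suc t + c ≡ c % Q + (a * Q ^ t + c / Q) * Q
    shiftDigit = trans (cong (a * Q ^ suc t +_) (m≡m%n+[m/n]*n c Q)) (regroup a (Q ^ t) (c % Q) (c / Q) Q)

  digitSum-shift : ∀ t a → digitSum (a * Q ^ t) ≡ digitSum a
  digitSum-shift t a = trans (cong digitSum (sym (+-identityʳ (a * Q ^ t))))
    (trans (digitSum-concat t a 0 (m^n>0 Q t)) (+-identityʳ (digitSum a)))

  value : List ℕ → ℕ
  value = fromDigitsMSB Q

  private
    push : ℕ → ℕ → ℕ
    push acc d = acc * Q + d

    foldl-push : ∀ ds acc → foldl push acc ds ≡ acc * Q ^ length ds + value ds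
    foldl-push []       acc = sym (trans (+-identityʳ _) (*-identityʳ acc))
    foldl-push (d ∷ ds) acc = begin
      foldl push (acc * Q + d) ds                               ≡⟨ foldl-push ds (acc * Q + d) ⟩
      (acc * Q + d) * Q ^ length ds + value ds                  ≡⟨ regroup acc Q d (Q ^ length ds) (value ds) ⟩
      acc * (Q * Q ^ length ds) + (d * Q ^ length ds + value ds) ≡⟨ cong (acc * (Q * Q ^ length ds) +_) (sym (foldl-push ds d)) ⟩
      acc * (Q * Q ^ length ds) + foldl push d ds               ∎
      where
      open ≡-Reasoning
      regroup : ∀ a q d w v → (a * q + d) * w + v ≡ a * (q * w) + (d * w + v)
      regroup = solve-∀

    digitSum-foldl : ∀ ds acc → All (_< Q) ds → digitSum (foldl push acc ds) ≡ digitSum acc + sum ds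
    digitSum-foldl []       acc []          = sym (+-identityʳ _)
    digitSum-foldl (d ∷ ds) acc (d<Q ∷ ds<Q) = begin
      digitSum (foldl push (acc * Q + d) ds)  ≡⟨ digitSum-foldl ds (acc * Q + d) ds<Q ⟩
      digitSum (acc * Q + d) + sum ds         ≡⟨ cong (λ z → digitSum z + sum ds) (+-comm (acc * Q) d) ⟩
      digitSum (d + acc * Q) + sum ds         ≡⟨ cong (_+ sum ds) (digitSum-digit acc d d<Q) ⟩
      d + digitSum acc + sum ds               ≡⟨ swap d (digitSum acc) (sum ds) ⟩
      digitSum acc + (d + sum ds)             ∎
      where
      open ≡-Reasoning
      swap : ∀ a b c → a + b + c ≡ b + (a + c)
      swap = solve-∀

  value-∷ : ∀ d ds → value (d ∷ ds) ≡ d * Q ^ length ds + value ds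
  value-∷ d ds = foldl-push ds d

  value-++ : ∀ xs ys → value (xs ++ ys) ≡ value xs * Q ^ length ys + value ys
  value-++ xs ys = trans (foldl-++ push 0 xs ys) (foldl-push ys (value xs))

  digitSum-value : ∀ ds → All (_< Q) ds → digitSum (value ds) ≡ sum ds
  digitSum-value ds ds<Q = digitSum-foldl ds 0 ds<Q

  value-complement : ∀ {xs ys} → Pointwise (λ x y → x + y ≡ suc b) xs ys →
    value xs + value ys + 1 ≡ Q ^ length xs
  value-complement []                       = refl
  value-complement {x ∷ xs} {y ∷ ys} (x+y ∷ rest) = begin
    value (x ∷ xs) + value (y ∷ ys) + 1
      ≡⟨ cong₂ (λ v w → v + w + 1) (value-∷ x xs) (trans (value-∷ y ys) (cong (λ l → y * Q ^ l + value ys) (sym (Pointwise-length rest)))) ⟩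
    x * Q ^ L + value xs + (y * Q ^ L + value ys) + 1
      ≡⟨ regroup x y (Q ^ L) (value xs) (value ys) ⟩
    (x + y) * Q ^ L + (value xs + value ys + 1)
      ≡⟨ cong₂ (λ c v → c * Q ^ L + v) x+y (value-complement rest) ⟩
    suc b * Q ^ L + Q ^ L
      ≡⟨ +-comm (suc b * Q ^ L) (Q ^ L) ⟩
    Q * Q ^ L ∎
    where
    open ≡-Reasoning
    L : ℕ
    L = length xs
    regroup : ∀ x y w v v' → x * w + v + (y * w + v') + 1 ≡ (x + y) * w + (v + v' + 1)
    regroup = solve-∀

  value-scale : ∀ e {xs ys} → Pointwise (λ x y → x ≡ e * y) xs ys → value xs ≡ e * value ys
  value-scale e []                               = sym (*-zeroʳ e)
  value-scale e {x ∷ xs} {y ∷ ys} (x≡ey ∷ rest) = begin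
    value (x ∷ xs)                  ≡⟨ value-∷ x xs ⟩
    x * Q ^ length xs + value xs    ≡⟨ cong₂ (λ c v → c * Q ^ length xs + v) x≡ey (value-scale e rest) ⟩
    e * y * Q ^ length xs + e * value ys ≡⟨ cong (λ l → e * y * Q ^ l + e * value ys) (Pointwise-length rest) ⟩
    e * y * Q ^ length ys + e * value ys ≡⟨ factor e y (Q ^ length ys) (value ys) ⟩
    e * (y * Q ^ length ys + value ys) ≡⟨ cong (e *_) (sym (value-∷ y ys)) ⟩
    e * value (y ∷ ys) ∎
    where
    open ≡-Reasoning
    factor : ∀ e y w v → e * y * w + e * v ≡ e * (y * w + v)
    factor = solve-∀

  -- A polynomial at x = Q^k whose coefficients have at most k digits: the digit
  -- blocks do not overlap, so the digit sums of the coefficients add up.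
  digitSum-eval : ∀ k n (g : ℕ → ℕ) → (∀ i → i < n → g i < Q ^ k) →
    digitSum (eval n g (Q ^ k)) ≡ sumTo n (λ i → digitSum (g i))
  digitSum-eval k zero    g _     = refl
  digitSum-eval k (suc n) g small = begin
    digitSum (eval n g x + g n * x ^ n)
      ≡⟨ cong digitSum (trans (+-comm (eval n g x) _) (cong (λ z → g n * z + eval n g x) (^-*-assoc Q k n))) ⟩
    digitSum (g n * Q ^ (k * n) + eval n g x)
      ≡⟨ digitSum-concat (k * n) (g n) (eval n g x) (subst (eval n g x <_) (^-*-assoc Q k n) (eval< n g x small′)) ⟩
    digitSum (g n) + digitSum (eval n g x)
      ≡⟨ cong (digitSum (g n) +_) (digitSum-eval k n g small′) ⟩
    digitSum (g n) + sumTo n (λ i → digitSum (g i))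
      ≡⟨ +-comm (digitSum (g n)) _ ⟩
    sumTo n (λ i → digitSum (g i)) + digitSum (g n) ∎
    where
    open ≡-Reasoning
    x : ℕ
    x = Q ^ k
    small′ : ∀ i → i < n → g i < x
    small′ i i<n = small i (m<n⇒m<1+n i<n)

module Offsets where

  open import Data.Nat
  open import Data.Nat.Properties
  open import Data.Nat.Tactic.RingSolver using (solve-∀)
  open import Data.Sum using (inj₁; inj₂)
  open import Data.Empty using (⊥-elim)
  open import Relation.Binary.PropositionalEquality
  open FiniteSums

  -- offset m j = Σ_{i<j} (m + 1 - i).  Counting from the least significant end,
  -- the j-th digit 1 of the string above sits at position k·j + offset m j.
  offset : ℕ → ℕ → ℕ
  offset m zero    = 0
  offset m (suc j) = offset m j + (suc m ∸ j)

  private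
    gap : ∀ m j → j ≤ m → suc m ∸ j ≡ suc (m ∸ j)
    gap m j j≤m = +-∸-assoc 1 j≤m

  -- Passing from m to m + 1 adds one to each of the first j gaps.
  offset-suc : ∀ m j → j ≤ suc m → offset (suc m) j ≡ offset m j + j
  offset-suc m zero    _           = refl
  offset-suc m (suc j) (s≤s j≤m) = begin
    offset (suc m) j + (suc (suc m) ∸ j)
      ≡⟨ cong₂ _+_ (offset-suc m j (m≤n⇒m≤1+n j≤m)) (gap (suc m) j (m≤n⇒m≤1+n j≤m)) ⟩
    offset m j + j + suc (suc m ∸ j)   ≡⟨ swap (offset m j) j (suc m ∸ j) ⟩
    offset m j + (suc m ∸ j) + suc j   ∎
    where
    open ≡-Reasoning
    swap : ∀ a b d → a + b + suc d ≡ a + d + suc b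
    swap = solve-∀

  offset-last : ∀ m → offset m (suc m) ≡ suc (offset m m)
  offset-last m = trans (cong (offset m m +_) (trans (gap m m ≤-refl) (cong suc (n∸n≡0 m)))) (+-comm (offset m m) 1)

  offset-last2 : ∀ m → offset (suc m) (suc m) ≡ 2 + offset (suc m) m
  offset-last2 m = trans (cong (offset (suc m) m +_) (trans (gap (suc m) m (n≤1+n m)) (cong suc (trans (gap m m ≤-refl) (cong suc (n∸n≡0 m))))))
    (+-comm (offset (suc m) m) 2)

  offset-inc : ∀ m j → j ≤ m → suc (offset m j) ≤ offset m (suc j)
  offset-inc m j j≤m = subst (_≤ offset m j + (suc m ∸ j)) (+-comm (offset m j) 1)
    (+-monoʳ-≤ (offset m j) (subst (1 ≤_) (sym (gap m j j≤m)) (s≤s z≤n)))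

  offset-mono : ∀ m {i j} → i ≤ j → offset m i ≤ offset m j
  offset-mono m {j = zero}      z≤n = ≤-refl
  offset-mono m {i} {suc j} i≤sj with m≤n⇒m<n∨m≡n i≤sj
  ... | inj₁ (s≤s i≤j) = ≤-trans (offset-mono m i≤j) (m≤m+n _ _)
  ... | inj₂ refl      = ≤-refl

  -- Each gap is at most m + 1.
  offset≤ : ∀ m j → offset m j ≤ j * suc m
  offset≤ m zero    = z≤n
  offset≤ m (suc j) = subst (offset m j + (suc m ∸ j) ≤_) (+-comm (j * suc m) (suc m))
    (+-mono-≤ (offset≤ m j) (m∸n≤m (suc m) j))

  indLe : ℕ → ℕ → ℕ
  indLe m       zero    = 1
  indLe zero    (suc j) = 0
  indLe (suc m) (suc j) = indLe m j

  indLe-≤ : ∀ m j → j ≤ m → indLe m j ≡ 1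
  indLe-≤ m       zero    _         = refl
  indLe-≤ (suc m) (suc j) (s≤s j≤m) = indLe-≤ m j j≤m

  indLe-> : ∀ m j → m < j → indLe m j ≡ 0
  indLe-> zero    (suc j) _         = refl
  indLe-> (suc m) (suc j) (s≤s m<j) = indLe-> m j m<j

  indLe≤1 : ∀ m j → indLe m j ≤ 1
  indLe≤1 m       zero    = ≤-refl
  indLe≤1 zero    (suc j) = z≤n
  indLe≤1 (suc m) (suc j) = indLe≤1 m j

  sumTo-indLe : ∀ K d (g : ℕ → ℕ) → sumTo (suc K + d) (λ i → indLe K i * g i) ≡ sumTo (suc K) g
  sumTo-indLe K d g = begin
    sumTo (suc K + d) (λ i → indLe K i * g i)
      ≡⟨ sumTo-split (suc K) d _ ⟩
    sumTo (suc K) (λ i → indLe K i * g i) + sumTo d (λ j → indLe K (suc K + j) * g (suc K + j))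
      ≡⟨ cong₂ _+_ (sumTo-cong (suc K) _ _ (λ i i≤K → trans (cong (_* g i) (indLe-≤ K i (≤-pred i≤K))) (+-identityʳ (g i))))
                   (sumTo-zero d _ (λ j _ → cong (_* g (suc K + j)) (indLe-> K (suc K + j) (s≤s (m≤m+n K j))))) ⟩
    sumTo (suc K) g + 0 ≡⟨ +-identityʳ _ ⟩
    sumTo (suc K) g ∎
    where open ≡-Reasoning

  indEq : ℕ → ℕ → ℕ
  indEq zero    zero    = 1
  indEq zero    (suc _) = 0
  indEq (suc _) zero    = 0
  indEq (suc i) (suc m) = indEq i m

  indEq-refl : ∀ m → indEq m m ≡ 1
  indEq-refl zero    = refl
  indEq-refl (suc m) = indEq-refl m

  indEq-≢ : ∀ i m → i ≢ m → indEq i m ≡ 0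
  indEq-≢ zero    zero    i≢m = ⊥-elim (i≢m refl)
  indEq-≢ zero    (suc m) _   = refl
  indEq-≢ (suc i) zero    _   = refl
  indEq-≢ (suc i) (suc m) i≢m = indEq-≢ i m (λ eq → i≢m (cong suc eq))

  sumTo-indEq : ∀ m d K → sumTo (suc m + d) (λ i → indEq i m * K) ≡ K
  sumTo-indEq m d K = begin
    sumTo (suc m + d) (λ i → indEq i m * K)
      ≡⟨ sumTo-split (suc m) d _ ⟩
    sumTo m (λ i → indEq i m * K) + indEq m m * K + sumTo d (λ j → indEq (suc m + j) m * K)
      ≡⟨ cong₂ _+_ (cong₂ _+_ (sumTo-zero m _ (λ i i<m → cong (_* K) (indEq-≢ i m (<⇒≢ i<m))))
                              (cong (_* K) (indEq-refl m)))
                   (sumTo-zero d _ (λ j _ → cong (_* K) (indEq-≢ (suc m + j) m (>⇒≢ (s≤s (m≤m+n m j)))))) ⟩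
    0 + 1 * K + 0 ≡⟨ trans (+-identityʳ _) (+-identityʳ K) ⟩
    K ∎
    where open ≡-Reasoning

  delay : ℕ → (ℕ → ℕ) → ℕ → ℕ
  delay zero    g t       = g t
  delay (suc m) g zero    = 0
  delay (suc m) g (suc t) = delay m g t

  delay-≥ : ∀ m g j → delay m g (m + j) ≡ g j
  delay-≥ zero    g j = refl
  delay-≥ (suc m) g j = delay-≥ m g j

  delay-< : ∀ m g t → t < m → delay m g t ≡ 0
  delay-< (suc m) g zero    _         = refl
  delay-< (suc m) g (suc t) (s≤s t<m) = delay-< m g t t<m

module BlockStrings (b : ℕ) where

  open import Defs using (uDigits)
  open import Data.Nat
  open import Data.Nat.Properties
  open import Data.Nat.Tactic.RingSolver using (solve-∀)
  open import Data.List using (List; []; _∷_; _++_; replicate; concat; length; applyUpTo)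
  open import Data.List.Properties using (length-++; length-replicate; ++-identityʳ; map-upTo)
  open import Data.Nat.ListAction using (sum)
  open import Data.Nat.ListAction.Properties using (sum-++)
  open import Data.List.Relation.Unary.All using (All; []; _∷_)
  import Data.List.Relation.Unary.All.Properties as All
  open import Data.List.Relation.Binary.Pointwise as Pw using (Pointwise; []; _∷_)
  open import Relation.Binary.PropositionalEquality
  open FiniteSums
  open Offsets
  open Digits b

  block : ℕ → ℕ → ℕ → List ℕ
  block a e k = replicate k a ++ e ∷ []

  blocks : ℕ → ℕ → ℕ → ℕ → List ℕ
  blocks a e k zero    = block a e k
  blocks a e k (suc m) = block a e k ++ blocks a e (suc k) m

  uDigits-blocks : ∀ m k n → uDigits Q m k n ≡ blocks (suc b) b k m ++ replicate n (suc b)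
  uDigits-blocks m k n = cong (_++ replicate n (suc b))
    (trans (cong concat (map-upTo (λ i → block (suc b) b (k + i)) (suc m))) (concat-blocks (suc b) b k m))
    where
    applyUpTo-cong : ∀ (f g : ℕ → List ℕ) n → (∀ i → f i ≡ g i) → applyUpTo f n ≡ applyUpTo g n
    applyUpTo-cong f g zero    eq = refl
    applyUpTo-cong f g (suc n) eq = cong₂ _∷_ (eq 0) (applyUpTo-cong (λ i → f (suc i)) (λ i → g (suc i)) n (λ i → eq (suc i)))
    concat-blocks : ∀ a e k m → concat (applyUpTo (λ i → block a e (k + i)) (suc m)) ≡ blocks a e k m
    concat-blocks a e k zero    = trans (++-identityʳ _) (cong (block a e) (+-identityʳ k))
    concat-blocks a e k (suc m) = cong₂ _++_ (cong (block a e) (+-identityʳ k))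
      (trans (cong concat (applyUpTo-cong _ (λ i → block a e (suc k + i)) (suc m) (λ i → cong (block a e) (+-suc k i))))
             (concat-blocks a e (suc k) m))

  blocks⁺ : ∀ {R : ℕ → ℕ → Set} {a a' e e'} → R a a' → R e e' → ∀ k m → Pointwise R (blocks a e k m) (blocks a' e' k m)
  blocks⁺ Ra Re k zero    = Pw.++⁺ (Pw.replicate⁺ Ra k) (Re ∷ [])
  blocks⁺ Ra Re k (suc m) = Pw.++⁺ (Pw.++⁺ (Pw.replicate⁺ Ra k) (Re ∷ [])) (blocks⁺ Ra Re (suc k) m)

  blocks-all : ∀ {a e} → a < Q → e < Q → ∀ k m → All (_< Q) (blocks a e k m)
  blocks-all a<Q e<Q k zero    = All.++⁺ (All.replicate⁺ k a<Q) (e<Q ∷ [])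
  blocks-all a<Q e<Q k (suc m) = All.++⁺ (All.++⁺ (All.replicate⁺ k a<Q) (e<Q ∷ [])) (blocks-all a<Q e<Q (suc k) m)

  blocksLength : ℕ → ℕ → ℕ
  blocksLength k m = suc m * k + offset m (suc m)

  block-length : ∀ a e k → length (block a e k) ≡ suc k
  block-length a e k = trans (length-++ (replicate k a)) (trans (cong (_+ 1) (length-replicate k)) (+-comm k 1))

  blocks-length : ∀ a e k m → length (blocks a e k m) ≡ blocksLength k m
  blocks-length a e k zero    = trans (block-length a e k) (one k)
    where
    one : ∀ k → suc k ≡ 1 * k + 1
    one = solve-∀
  blocks-length a e k (suc m) = begin
    length (block a e k ++ blocks a e (suc k) m)
      ≡⟨ trans (length-++ (block a e k)) (cong₂ _+_ (block-length a e k) (blocks-length a e (suc k) m)) ⟩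
    suc k + (suc m * suc k + offset m (suc m))
      ≡⟨ regroup k m (offset m (suc m)) ⟩
    suc (suc m) * k + suc (offset m (suc m) + suc m)
      ≡⟨ cong (λ z → suc (suc m) * k + suc z) (sym (offset-suc m (suc m) ≤-refl)) ⟩
    suc (suc m) * k + suc (offset (suc m) (suc m))
      ≡⟨ cong (suc (suc m) * k +_) (sym (offset-last (suc m))) ⟩
    blocksLength k (suc m) ∎
    where
    open ≡-Reasoning
    regroup : ∀ k m c → suc k + (suc m * suc k + c) ≡ suc (suc m) * k + suc (c + suc m)
    regroup = solve-∀

  sum-replicate : ∀ n a → sum (replicate n a) ≡ n * a
  sum-replicate zero    a = refl
  sum-replicate (suc n) a = cong (a +_) (sum-replicate n a)

  block-sum : ∀ a e k → sum (block a e k) ≡ k * a + e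
  block-sum a e k = trans (sum-++ (replicate k a) (e ∷ [])) (cong₂ _+_ (sum-replicate k a) (+-identityʳ e))

  blocks-sum : ∀ a e k m → sum (blocks a e k m) + a * suc m ≡ a * blocksLength k m + e * suc m
  blocks-sum a e k m = subst (λ L → sum (blocks a e k m) + a * suc m ≡ a * L + e * suc m) (blocks-length a e k m) (go k m)
    where
    open ≡-Reasoning
    go : ∀ k m → sum (blocks a e k m) + a * suc m ≡ a * length (blocks a e k m) + e * suc m
    go k zero = begin
      sum (block a e k) + a * 1        ≡⟨ cong (_+ a * 1) (block-sum a e k) ⟩
      k * a + e + a * 1                ≡⟨ regroup₁ k a e ⟩
      a * suc k + e * 1                ≡⟨ cong (λ L → a * L + e * 1) (sym (block-length a e k)) ⟩
      a * length (block a e k) + e * 1 ∎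
      where
      regroup₁ : ∀ k a e → k * a + e + a * 1 ≡ a * suc k + e * 1
      regroup₁ = solve-∀
    go k (suc m) = begin
      sum (block a e k ++ rest) + a * suc (suc m)
        ≡⟨ cong (_+ a * suc (suc m)) (trans (sum-++ (block a e k) rest) (cong (_+ sum rest) (block-sum a e k))) ⟩
      k * a + e + sum rest + a * suc (suc m)
        ≡⟨ regroup₁ k a e (sum rest) m ⟩
      (sum rest + a * suc m) + (k * a + e + a)
        ≡⟨ cong (_+ (k * a + e + a)) (go (suc k) m) ⟩
      (a * length rest + e * suc m) + (k * a + e + a)
        ≡⟨ regroup₂ a (length rest) e m k ⟩
      a * (suc k + length rest) + e * suc (suc m)
        ≡⟨ cong (λ L → a * L + e * suc (suc m)) (sym (trans (length-++ (block a e k)) (cong (_+ length rest) (block-length a e k)))) ⟩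
      a * length (block a e k ++ rest) + e * suc (suc m) ∎
      where
      rest : List ℕ
      rest = blocks a e (suc k) m
      regroup₁ : ∀ k a e S m → k * a + e + S + a * suc (suc m) ≡ (S + a * suc m) + (k * a + e + a)
      regroup₁ = solve-∀
      regroup₂ : ∀ a L e m k → (a * L + e * suc m) + (k * a + e + a) ≡ a * (suc k + L) + e * suc (suc m)
      regroup₂ = solve-∀

  value-zeros : ∀ n → value (replicate n 0) ≡ 0
  value-zeros n = value-scale 0 {replicate n 0} {replicate n 0} (Pw.replicate⁺ refl n)

  value-maxDigits : ∀ n → value (replicate n (suc b)) + 1 ≡ Q ^ n
  value-maxDigits n = begin
    value (replicate n (suc b)) + 1
      ≡⟨ cong (_+ 1) (sym (trans (cong (value (replicate n (suc b)) +_) (value-zeros n)) (+-identityʳ _))) ⟩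
    value (replicate n (suc b)) + value (replicate n 0) + 1
      ≡⟨ value-complement (Pw.replicate⁺ {R = λ x y → x + y ≡ suc b} (+-identityʳ (suc b)) n) ⟩
    Q ^ length (replicate n (suc b))
      ≡⟨ cong (Q ^_) (length-replicate n) ⟩
    Q ^ n ∎
    where open ≡-Reasoning

  value-block0 : ∀ e k → value (block 0 e k) ≡ e
  value-block0 e k = trans (value-++ (replicate k 0) (e ∷ []))
    (cong (λ v → v * Q ^ 1 + e) (value-zeros k))

  value-ones : ∀ k m → value (blocks 0 1 k m) ≡ sumTo (suc m) (λ j → Q ^ (k * j + offset m j))
  value-ones k zero    = trans (value-block0 1 k) (cong (Q ^_) (sym (trans (+-identityʳ (k * 0)) (*-zeroʳ k))))
  value-ones k (suc m) = begin
    value (block 0 1 k ++ rest)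
      ≡⟨ value-++ (block 0 1 k) rest ⟩
    value (block 0 1 k) * Q ^ length rest + value rest
      ≡⟨ cong₂ (λ v L → v * Q ^ L + value rest) (value-block0 1 k) (blocks-length 0 1 (suc k) m) ⟩
    1 * Q ^ blocksLength (suc k) m + value rest
      ≡⟨ cong₂ _+_ (trans (*-identityˡ _) (cong (Q ^_) top)) (value-ones (suc k) m) ⟩
    Q ^ (k * suc m + offset (suc m) (suc m)) + sumTo (suc m) (λ j → Q ^ (suc k * j + offset m j))
      ≡⟨ +-comm (Q ^ (k * suc m + offset (suc m) (suc m))) _ ⟩
    sumTo (suc m) (λ j → Q ^ (suc k * j + offset m j)) + Q ^ (k * suc m + offset (suc m) (suc m))
      ≡⟨ cong (_+ Q ^ (k * suc m + offset (suc m) (suc m))) (sumTo-cong (suc m) _ _ lower) ⟩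
    sumTo (suc (suc m)) (λ j → Q ^ (k * j + offset (suc m) j)) ∎
    where
    open ≡-Reasoning
    rest : List ℕ
    rest = blocks 0 1 (suc k) m
    regroup : ∀ k j c → suc k * j + c ≡ k * j + (c + j)
    regroup = solve-∀
    lower : ∀ j → j < suc m → Q ^ (suc k * j + offset m j) ≡ Q ^ (k * j + offset (suc m) j)
    lower j j≤m = cong (Q ^_) (trans (regroup k j (offset m j)) (cong (k * j +_) (sym (offset-suc m j (m≤n⇒m≤1+n (≤-pred j≤m))))))
    top : blocksLength (suc k) m ≡ k * suc m + offset (suc m) (suc m)
    top = trans (regroup′ k m (offset m (suc m))) (cong (k * suc m +_) (sym (offset-suc m (suc m) ≤-refl)))
      where
      regroup′ : ∀ k m c → suc m * suc k + c ≡ k * suc m + (c + suc m)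
      regroup′ = solve-∀

-- The number A = value (blocks 0 1 k m) is the polynomial Σ_{j≤m} coef j · x^j at
-- x = Q^k.  This module bounds the coefficients of its square; all bounds are
-- independent of k.
module Coefficients (b m₀ : ℕ) where

  open import Data.Nat
  open import Data.Nat.Properties
  open import Data.Nat.Tactic.RingSolver using (solve-∀)
  open import Data.Sum using (inj₁; inj₂)
  open import Relation.Binary.Definitions using (tri<; tri≈; tri>)
  open import Relation.Nullary using (yes; no)
  open import Relation.Binary.PropositionalEquality
  open FiniteSums
  open Offsets
  open Digits b using (Q; digitSum)

  m : ℕ
  m = suc m₀

  -- c = offset m m is the top offset; offset m m₀ = c - 2 (offset-last2).
  c c₀ : ℕ
  c  = offset m m
  c₀ = offset m m₀

  coef : ℕ → ℕ
  coef j = indLe m j * Q ^ offset m j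

  square : ℕ → ℕ
  square = conv coef coef

  -- With W = Q^(blocksLength k m) = x^(m+1) · Q^(c+1), the coefficient of x^(m+1+j)
  -- in 2·W·A is crossTerm j.
  crossTerm : ℕ → ℕ
  crossTerm j = 2 * Q ^ offset m (suc m) * Q ^ offset m j

  -- cross t is the coefficient of x^(t+1) in 2·W·A (for t < 2m); it vanishes for t < m.
  cross : ℕ → ℕ
  cross = delay m crossTerm

  -- low t is the coefficient of x^(t+1) in Y² - 1 = (W - A)² - 1, for t < 2m.
  low : ℕ → ℕ
  low t = square (suc t) ∸ cross t

  -- The total digit sum of the low coefficients; it depends only on Q and m.
  lowDigitSum : ℕ
  lowDigitSum = sumTo (m + m) (λ t → digitSum (low t))

  coef-≤ : ∀ j → j ≤ m → coef j ≡ Q ^ offset m j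
  coef-≤ j j≤m = trans (cong (_* Q ^ offset m j) (indLe-≤ m j j≤m)) (*-identityˡ _)

  coef-> : ∀ j → m < j → coef j ≡ 0
  coef-> j m<j = cong (_* Q ^ offset m j) (indLe-> m j m<j)

  coef≤ : ∀ K j → j ≤ K → coef j ≤ Q ^ offset m K
  coef≤ K j j≤K = ≤-trans (subst (coef j ≤_) (*-identityˡ _) (*-monoˡ-≤ (Q ^ offset m j) (indLe≤1 m j)))
    (^-monoʳ-≤ Q (offset-mono m j≤K))

  coef≤top : ∀ j → coef j ≤ Q ^ c
  coef≤top j with j ≤? m
  ... | yes j≤m = coef≤ m j j≤m
  ... | no  j≰m = subst (_≤ Q ^ c) (sym (coef-> j (≰⇒> j≰m))) z≤n

  private
    2≤Q : 2 ≤ Q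
    2≤Q = s≤s (s≤s z≤n)

  -- For j + 1 < m, the two terms of square (m + j + 1) with indices j + 1 and m
  -- each dominate half of crossTerm j, because offsets strictly increase.
  crossTerm≤square-inner : ∀ j → suc j < m → crossTerm j ≤ square (suc (m + j))
  crossTerm≤square-inner j (s≤s j<m₀) = begin
    2 * Q ^ offset m (suc m) * Q ^ offset m j          ≡⟨ cong (λ e → 2 * Q ^ e * Q ^ offset m j) (offset-last m) ⟩
    2 * Q ^ suc c * Q ^ offset m j                     ≡⟨ *-assoc 2 (Q ^ suc c) _ ⟩
    2 * (Q ^ suc c * Q ^ offset m j)                   ≤⟨ *-monoʳ-≤ 2 grow ⟩
    2 * (Q ^ offset m (suc j) * Q ^ c)                 ≡⟨ double (Q ^ offset m (suc j)) (Q ^ c) ⟩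
    Q ^ offset m (suc j) * Q ^ c + Q ^ c * Q ^ offset m (suc j)
      ≡⟨ sym (cong₂ _+_ (cong₂ _*_ (coef-≤ (suc j) j+1≤m) (trans (cong coef s∸[j+1]) (coef-≤ m ≤-refl)))
                        (cong₂ _*_ (coef-≤ m ≤-refl) (trans (cong coef s∸m) (coef-≤ (suc j) j+1≤m)))) ⟩
    coef (suc j) * coef (s ∸ suc j) + coef m * coef (s ∸ m)
      ≤⟨ twoTerms≤sumTo (suc s) (λ i → coef i * coef (s ∸ i)) (suc j) m (s≤s j<m₀) (s≤s (s≤s (≤-trans (n≤1+n m₀) (m≤m+n m j)))) ⟩
    square s ∎
    where
    open ≤-Reasoning
    s : ℕ
    s = suc (m + j)
    j+1≤m : suc j ≤ m
    j+1≤m = s≤s (<⇒≤ j<m₀)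
    s∸[j+1] : s ∸ suc j ≡ m
    s∸[j+1] = m+n∸n≡m m j
    s∸m : s ∸ m ≡ suc j
    s∸m = trans (cong (_∸ m) (sym (+-suc m j))) (m+n∸m≡n m (suc j))
    double : ∀ x y → 2 * (x * y) ≡ x * y + y * x
    double = solve-∀
    grow : Q ^ suc c * Q ^ offset m j ≤ Q ^ offset m (suc j) * Q ^ c
    grow = subst₂ _≤_ (^-distribˡ-+-* Q (suc c) (offset m j)) (^-distribˡ-+-* Q (offset m (suc j)) c)
      (^-monoʳ-≤ Q (subst (_≤ offset m (suc j) + c) (cong suc (+-comm (offset m j) c))
        (+-monoˡ-≤ c (offset-inc m j (≤-trans (<⇒≤ j<m₀) (n≤1+n m₀))))))

  -- For j + 1 = m, the single term Q^c · Q^c of square (2m) dominates crossTerm j,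
  -- because the last gap before the top offset is 2 and Q ≥ 2.
  crossTerm≤square-last : crossTerm m₀ ≤ square (suc (m + m₀))
  crossTerm≤square-last = begin
    2 * Q ^ offset m (suc m) * Q ^ c₀
      ≡⟨ cong (λ e → 2 * Q ^ e * Q ^ c₀) (trans (offset-last m) (cong suc (offset-last2 m₀))) ⟩
    2 * (Q * (Q * (Q * Q ^ c₀))) * Q ^ c₀
      ≤⟨ *-monoˡ-≤ (Q ^ c₀) (*-monoˡ-≤ (Q * (Q * (Q * Q ^ c₀))) 2≤Q) ⟩
    Q * (Q * (Q * (Q * Q ^ c₀))) * Q ^ c₀
      ≡⟨ regroup Q (Q ^ c₀) ⟩
    (Q * (Q * Q ^ c₀)) * (Q * (Q * Q ^ c₀))
      ≡⟨ sym (cong₂ _*_ (cong (Q ^_) (offset-last2 m₀)) (cong (Q ^_) (offset-last2 m₀))) ⟩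
    Q ^ c * Q ^ c
      ≡⟨ sym (cong₂ _*_ (coef-≤ m ≤-refl) (trans (cong coef s∸m) (coef-≤ m ≤-refl))) ⟩
    coef m * coef (s ∸ m)
      ≤⟨ term≤sumTo (suc s) (λ i → coef i * coef (s ∸ i)) m (s≤s (s≤s (≤-trans (n≤1+n m₀) (m≤m+n m m₀)))) ⟩
    square s ∎
    where
    open ≤-Reasoning
    s : ℕ
    s = suc (m + m₀)
    s∸m : s ∸ m ≡ m
    s∸m = trans (cong (_∸ m) (sym (+-suc m m₀))) (m+n∸m≡n m m)
    regroup : ∀ q x → q * (q * (q * (q * x))) * x ≡ (q * (q * x)) * (q * (q * x))
    regroup = solve-∀

  -- Hence subtracting cross from the shifted square is exact.
  cross≤square : ∀ t → t < m + m → cross t ≤ square (suc t)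
  cross≤square t t<2m with t <? m
  ... | yes t<m = subst (_≤ square (suc t)) (sym (delay-< m _ t t<m)) z≤n
  ... | no  t≮m = subst (λ z → cross z ≤ square (suc z)) (m+[n∸m]≡n m≤t)
          (subst (_≤ square (suc (m + j))) (sym (delay-≥ m crossTerm j)) inner)
    where
    m≤t : m ≤ t
    m≤t = ≮⇒≥ t≮m
    j : ℕ
    j = t ∸ m
    inner : crossTerm j ≤ square (suc (m + j))
    inner with m≤n⇒m<n∨m≡n (m<n+o⇒m∸n<o t m t<2m)
    ... | inj₁ j+1<m = crossTerm≤square-inner j j+1<m
    ... | inj₂ j+1≡m = subst (λ z → crossTerm z ≤ square (suc (m + z))) (sym (suc-injective j+1≡m)) crossTerm≤square-last

  cross-pos : ∀ t → m ≤ t → 1 ≤ cross t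
  cross-pos t m≤t = subst (λ z → 1 ≤ cross z) (m+[n∸m]≡n m≤t) (subst (1 ≤_) (sym (delay-≥ m crossTerm (t ∸ m)))
     (pos* (pos* {2} (s≤s z≤n) (m^n>0 Q (offset m (suc m)))) (m^n>0 Q (offset m (t ∸ m)))))
    where
    pos* : ∀ {x y} → 1 ≤ x → 1 ≤ y → 1 ≤ x * y
    pos* {x} {y} = *-mono-≤ {1} {x} {1} {y}

  sumPowers< : ∀ (e : ℕ → ℕ) j → (∀ i → i < j → suc (e i) ≤ e (suc i)) →
    sumTo (suc j) (λ i → Q ^ e i) < Q ^ suc (e j)
  sumPowers< e zero    _   = subst (Q ^ e 0 <_) (*-comm (Q ^ e 0) Q) (m<m*n (Q ^ e 0) Q {{m^n≢0 Q (e 0)}} 2≤Q)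
  sumPowers< e (suc j) inc = begin-strict
    sumTo (suc j) (λ i → Q ^ e i) + Q ^ e (suc j)  <⟨ +-monoˡ-< (Q ^ e (suc j)) (sumPowers< e j (λ i i<j → inc i (m<n⇒m<1+n i<j))) ⟩
    Q ^ suc (e j) + Q ^ e (suc j)                  ≤⟨ +-monoˡ-≤ (Q ^ e (suc j)) (^-monoʳ-≤ Q (inc j ≤-refl)) ⟩
    Q ^ e (suc j) + Q ^ e (suc j)                  ≡⟨ double (Q ^ e (suc j)) ⟩
    2 * Q ^ e (suc j)                              ≤⟨ *-monoˡ-≤ (Q ^ e (suc j)) 2≤Q ⟩
    Q ^ suc (e (suc j)) ∎
    where
    open ≤-Reasoning
    double : ∀ x → x + x ≡ 2 * x
    double = solve-∀

  -- For s < 2m, the term of square s with index i is bounded by bound i: for i < m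
  -- use coef (s - i) ≤ Q^c, and for i = m use s - m < m.
  bound : ℕ → ℕ
  bound i = indLe m₀ i * (Q ^ offset m i * Q ^ c) + indEq i m * (Q ^ c * Q ^ c₀)

  term≤bound : ∀ s → s < m + m → ∀ i → coef i * coef (s ∸ i) ≤ bound i
  term≤bound s s<2m i with <-cmp i m
  ... | tri< i<m _ _ = ≤-trans (begin
    coef i * coef (s ∸ i)           ≤⟨ *-monoʳ-≤ (coef i) (coef≤top (s ∸ i)) ⟩
    coef i * Q ^ c                  ≡⟨ cong (_* Q ^ c) (coef-≤ i (<⇒≤ i<m)) ⟩
    Q ^ offset m i * Q ^ c          ≡⟨ sym (trans (cong (_* (Q ^ offset m i * Q ^ c)) (indLe-≤ m₀ i (≤-pred i<m))) (*-identityˡ _)) ⟩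
    indLe m₀ i * (Q ^ offset m i * Q ^ c) ∎) (m≤m+n _ _)
    where open ≤-Reasoning
  ... | tri≈ _ refl _ = ≤-trans (begin
    coef m * coef (s ∸ m)           ≤⟨ *-mono-≤ (coef≤top m) (coef≤ m₀ (s ∸ m) (≤-pred (m<n+o⇒m∸n<o s m s<2m))) ⟩
    Q ^ c * Q ^ c₀                  ≡⟨ sym (trans (cong (_* (Q ^ c * Q ^ c₀)) (indEq-refl m)) (*-identityˡ _)) ⟩
    indEq m m * (Q ^ c * Q ^ c₀)    ∎) (m≤n+m _ _)
    where open ≤-Reasoning
  ... | tri> _ _ m<i = subst (_≤ bound i) (sym (cong (_* coef (s ∸ i)) (coef-> i m<i))) z≤n

  square< : ∀ s → s < m + m → square s < Q ^ c * Q ^ c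
  square< s s<2m = begin-strict
    square s                     ≤⟨ sumTo-mono (suc s) _ bound (λ i _ → term≤bound s s<2m i) ⟩
    sumTo (suc s) bound          ≤⟨ sumTo-monoˡ bound s<2m ⟩
    sumTo (m + m) bound          ≡⟨ sumTo-+ (m + m) _ _ ⟩
    sumTo (suc m₀ + m) (λ i → indLe m₀ i * (Q ^ offset m i * Q ^ c)) + sumTo (m + m) (λ i → indEq i m * (Q ^ c * Q ^ c₀))
      ≡⟨ cong₂ _+_ (sumTo-indLe m₀ m _) (trans (cong (λ z → sumTo z (λ i → indEq i m * (Q ^ c * Q ^ c₀))) (cong suc (+-suc m₀ m₀)))
                                               (sumTo-indEq m m₀ _)) ⟩
    sumTo m (λ i → Q ^ offset m i * Q ^ c) + Q ^ c * Q ^ c₀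
      ≡⟨ cong (_+ Q ^ c * Q ^ c₀) (sym (sumTo-*ʳ m (λ i → Q ^ offset m i) (Q ^ c))) ⟩
    S * Q ^ c + Q ^ c * Q ^ c₀   ≡⟨ factor S (Q ^ c) (Q ^ c₀) ⟩
    (S + Q ^ c₀) * Q ^ c         <⟨ *-monoˡ-< (Q ^ c) {{m^n≢0 Q c}} (+-monoˡ-< (Q ^ c₀) S<) ⟩
    (Q * Q ^ c₀ + Q ^ c₀) * Q ^ c ≤⟨ *-monoˡ-≤ (Q ^ c) (subst₂ _≤_ (succ Q (Q ^ c₀)) (*-assoc Q Q (Q ^ c₀)) (*-monoˡ-≤ (Q ^ c₀) Q+1≤Q²)) ⟩
    Q * (Q * Q ^ c₀) * Q ^ c     ≡⟨ cong (_* Q ^ c) (sym (cong (Q ^_) (offset-last2 m₀))) ⟩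
    Q ^ c * Q ^ c ∎
    where
    open ≤-Reasoning
    S : ℕ
    S = sumTo m (λ i → Q ^ offset m i)
    S< : S < Q * Q ^ c₀
    S< = sumPowers< (offset m) m₀ (λ i i<m₀ → offset-inc m i (≤-trans (<⇒≤ i<m₀) (n≤1+n m₀)))
    factor : ∀ s a b → s * a + a * b ≡ (s + b) * a
    factor = solve-∀
    succ : ∀ q x → suc q * x ≡ q * x + x
    succ = solve-∀
    Q+1≤Q² : suc Q ≤ Q * Q
    Q+1≤Q² = subst (_≤ Q * Q) (+-comm Q 1) (+-monoʳ-≤ Q (s≤s z≤n))

  -- In degree 2m only the term coef m · coef m survives.
  square-top≤ : square (m + m) ≤ Q ^ c * Q ^ c
  square-top≤ = begin
    square (m + m)                                     ≤⟨ sumTo-mono (suc (m + m)) _ (λ i → indEq i m * (Q ^ c * Q ^ c)) bound-top ⟩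
    sumTo (suc m + m) (λ i → indEq i m * (Q ^ c * Q ^ c)) ≡⟨ sumTo-indEq m m _ ⟩
    Q ^ c * Q ^ c ∎
    where
    open ≤-Reasoning
    bound-top : ∀ i → i < suc (m + m) → coef i * coef (m + m ∸ i) ≤ indEq i m * (Q ^ c * Q ^ c)
    bound-top i _ with <-cmp i m
    ... | tri< i<m _ _ = subst (_≤ indEq i m * (Q ^ c * Q ^ c)) (sym (trans (cong (coef i *_) (coef-> (m + m ∸ i) m<2m-i)) (*-zeroʳ (coef i)))) z≤n
      where
      m<2m-i : m < m + m ∸ i
      m<2m-i = subst (m <_) (sym (+-∸-assoc m (<⇒≤ i<m))) (subst (_< m + (m ∸ i)) (+-identityʳ m) (+-monoʳ-< m (m<n⇒0<n∸m i<m)))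
    ... | tri≈ _ refl _ = subst (coef m * coef (m + m ∸ m) ≤_) (sym (trans (cong (_* (Q ^ c * Q ^ c)) (indEq-refl m)) (*-identityˡ _)))
                            (subst (λ z → coef m * coef z ≤ Q ^ c * Q ^ c) (sym (m+n∸n≡m m m)) (*-mono-≤ (coef≤top m) (coef≤top m)))
    ... | tri> _ _ m<i = subst (_≤ indEq i m * (Q ^ c * Q ^ c)) (sym (cong (_* coef (m + m ∸ i)) (coef-> i m<i))) z≤n

  -- All low coefficients are < Q^(2c); in the top degree this uses cross ≥ 1.
  low< : ∀ t → t < m + m → low t < Q ^ c * Q ^ c
  low< t t<2m with suc t <? m + m
  ... | yes t+1<2m = ≤-<-trans (m∸n≤m (square (suc t)) (cross t)) (square< (suc t) t+1<2m)
  ... | no  t+1≮2m = <-≤-trans (∸-monoʳ-< {square (suc t)} {cross t} {0} (cross-pos t m≤t) (cross≤square t t<2m))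
                               (subst (λ z → square z ≤ Q ^ c * Q ^ c) (sym t+1≡2m) square-top≤)
    where
    t+1≡2m : suc t ≡ m + m
    t+1≡2m = ≤-antisym t<2m (≮⇒≥ t+1≮2m)
    m≤t : m ≤ t
    m≤t = ≤-pred (subst (suc m ≤_) (sym t+1≡2m) (s≤s (m≤n+m m m₀)))

-- Let x = Q^k, A = value (blocks 0 1 k m), W = Q^(blocksLength k m) and Y = W - A,
-- which is one more than the value of blocks (Q-1) (Q-2) k m.
-- Then Y² - 1 = Z with Z = x · (Σ_{t<2m} low t · x^t + x^(2m) · Q^(2c+1) · T) and
-- T = value ((Q-1)^(k) (Q-2)); for 2c ≤ k the pieces of Z do not overlap.
module Square (b m₀ k : ℕ) where

  open import Data.Nat
  open import Data.Nat.Properties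
  open import Data.Nat.Tactic.RingSolver using (solve-∀)
  open import Data.List using ([]; _∷_; replicate)
  open import Data.List.Relation.Unary.All using (_∷_; [])
  import Data.List.Relation.Unary.All.Properties as All
  open import Relation.Binary.PropositionalEquality
  open FiniteSums
  open Offsets
  open Digits b
  open BlockStrings b
  open Coefficients b m₀

  x : ℕ
  x = Q ^ k

  A : ℕ
  A = value (blocks 0 1 k m)

  A′ : ℕ
  A′ = eval m coef x

  A-poly : A ≡ eval (suc m) coef x
  A-poly = trans (value-ones k m) (sumTo-cong (suc m) _ _ power)
    where
    open ≡-Reasoning
    power : ∀ j → j < suc m → Q ^ (k * j + offset m j) ≡ coef j * x ^ j
    power j j≤m = begin
      Q ^ (k * j + offset m j)      ≡⟨ ^-distribˡ-+-* Q (k * j) (offset m j) ⟩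
      Q ^ (k * j) * Q ^ offset m j  ≡⟨ *-comm (Q ^ (k * j)) _ ⟩
      Q ^ offset m j * Q ^ (k * j)  ≡⟨ cong₂ _*_ (sym (coef-≤ j (≤-pred j≤m))) (sym (^-*-assoc Q k j)) ⟩
      coef j * x ^ j ∎

  A-top : A ≡ A′ + Q ^ c * x ^ m
  A-top = trans A-poly (cong (λ z → A′ + z * x ^ m) (coef-≤ m ≤-refl))

  -- A² = 1 + x · Σ_{t<2m} square (t + 1) · x^t, since coef 0 = 1.
  A-square : A * A ≡ 1 + x * eval (m + m) (λ t → square (suc t)) x
  A-square = begin
    A * A                                                ≡⟨ cong₂ _*_ A-poly A-poly ⟩
    eval (suc m) coef x * eval (suc m) coef x           ≡⟨ sym (eval-square m coef x coef->) ⟩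
    eval (suc (m + m)) square x                          ≡⟨ sumTo-split 1 (m + m) _ ⟩
    1 + sumTo (m + m) (λ i → square (suc i) * (x * x ^ i))
      ≡⟨ cong (1 +_) (sumTo-cong (m + m) _ _ (λ i _ → swap (square (suc i)) x (x ^ i))) ⟩
    1 + sumTo (m + m) (λ i → square (suc i) * x ^ i * x) ≡⟨ cong (1 +_) (sym (sumTo-*ʳ (m + m) _ x)) ⟩
    1 + eval (m + m) (λ t → square (suc t)) x * x       ≡⟨ cong (1 +_) (*-comm _ x) ⟩
    1 + x * eval (m + m) (λ t → square (suc t)) x ∎
    where
    open ≡-Reasoning
    swap : ∀ a b c → a * (b * c) ≡ a * c * b
    swap = solve-∀

  square-split : eval (m + m) (λ t → square (suc t)) x ≡ eval (m + m) cross x + eval (m + m) low x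
  square-split = trans (sumTo-cong (m + m) _ _ split) (sumTo-+ (m + m) _ _)
    where
    split : ∀ t → t < m + m → square (suc t) * x ^ t ≡ cross t * x ^ t + low t * x ^ t
    split t t<2m = trans (cong (_* x ^ t) (sym (trans (+-comm (cross t) (low t)) (m∸n+n≡m (cross≤square t t<2m)))))
                         (*-distribʳ-+ (x ^ t) (cross t) (low t))

  eval-cross : eval (m + m) cross x ≡ 2 * (Q * Q ^ c) * x ^ m * A′
  eval-cross = begin
    eval (m + m) cross x
      ≡⟨ sumTo-split m m _ ⟩
    sumTo m (λ t → cross t * x ^ t) + sumTo m (λ j → cross (m + j) * x ^ (m + j))
      ≡⟨ cong₂ _+_ (sumTo-zero m _ (λ t t<m → cong (_* x ^ t) (delay-< m crossTerm t t<m))) (sumTo-cong m _ _ upper) ⟩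
    0 + sumTo m (λ j → K * (coef j * x ^ j))
      ≡⟨ sym (trans (*-comm K A′) (trans (sumTo-*ʳ m _ _) (sumTo-cong m _ _ (λ j _ → *-comm _ K)))) ⟩
    K * A′ ∎
    where
    open ≡-Reasoning
    K : ℕ
    K = 2 * (Q * Q ^ c) * x ^ m
    swap : ∀ a c b d → 2 * a * c * (b * d) ≡ 2 * a * b * (c * d)
    swap = solve-∀
    upper : ∀ j → j < m → cross (m + j) * x ^ (m + j) ≡ K * (coef j * x ^ j)
    upper j j<m = begin
      cross (m + j) * x ^ (m + j)                           ≡⟨ cong₂ _*_ (delay-≥ m crossTerm j) (^-distribˡ-+-* x m j) ⟩
      2 * Q ^ offset m (suc m) * Q ^ offset m j * (x ^ m * x ^ j) ≡⟨ cong (λ e → 2 * Q ^ e * Q ^ offset m j * (x ^ m * x ^ j)) (offset-last m) ⟩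
      2 * (Q * Q ^ c) * Q ^ offset m j * (x ^ m * x ^ j)    ≡⟨ swap (Q * Q ^ c) (Q ^ offset m j) (x ^ m) (x ^ j) ⟩
      K * (Q ^ offset m j * x ^ j)                          ≡⟨ cong (λ z → K * (z * x ^ j)) (sym (coef-≤ j (<⇒≤ j<m))) ⟩
      K * (coef j * x ^ j) ∎

  T : ℕ
  T = value (block (suc b) b k)

  T+2 : T + 2 ≡ Q * x
  T+2 = begin
    T + 2                                       ≡⟨ cong (_+ 2) (value-++ (replicate k (suc b)) (b ∷ [])) ⟩
    value (replicate k (suc b)) * Q ^ 1 + b + 2 ≡⟨ regroup (value (replicate k (suc b))) b ⟩
    Q * (value (replicate k (suc b)) + 1)      ≡⟨ cong (Q *_) (value-maxDigits k) ⟩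
    Q * x ∎
    where
    open ≡-Reasoning
    regroup : ∀ w b → w * ((2 + b) * 1) + b + 2 ≡ (2 + b) * (w + 1)
    regroup = solve-∀

  digitSum-T : digitSum T ≡ k * suc b + b
  digitSum-T = trans (digitSum-value (block (suc b) b k) (All.++⁺ (All.replicate⁺ k Q-1<Q) (Q-2<Q ∷ [])))
    (block-sum (suc b) b k)

  W : ℕ
  W = Q ^ blocksLength k m

  W-form : W ≡ x * x ^ m * (Q * Q ^ c)
  W-form = begin
    Q ^ (suc m * k + offset m (suc m))   ≡⟨ cong (λ e → Q ^ (suc m * k + e)) (offset-last m) ⟩
    Q ^ (suc m * k + suc c)              ≡⟨ ^-distribˡ-+-* Q (suc m * k) (suc c) ⟩
    Q ^ (suc m * k) * (Q * Q ^ c)        ≡⟨ cong (λ z → Q ^ z * (Q * Q ^ c)) (*-comm (suc m) k) ⟩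
    Q ^ (k * suc m) * (Q * Q ^ c)        ≡⟨ cong (_* (Q * Q ^ c)) (sym (^-*-assoc Q k (suc m))) ⟩
    x * x ^ m * (Q * Q ^ c) ∎
    where open ≡-Reasoning

  Y : ℕ
  Y = suc (value (blocks (suc b) b k m))

  Y+A : Y + A ≡ W
  Y+A = trans (sym (+-comm (value (blocks (suc b) b k m) + A) 1))
    (trans (value-complement (blocks⁺ {R = λ d d′ → d + d′ ≡ suc b} (+-identityʳ (suc b)) (+-comm b 1) k m))
           (cong (Q ^_) (blocks-length (suc b) b k m)))

  -- Y² - 1, written as x times the concatenation of T (shifted by 2c + 1 and by 2m
  -- blocks of k digits) with the low coefficients.
  Z : ℕ
  Z = x * (eval (m + m) low x + x ^ m * x ^ m * (Q ^ c * Q ^ c * Q) * T)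

  -- Z + 1 + 2WA and Y² + 2WA both equal A² + W².
  Y-square : Z + 1 ≡ Y * Y
  Y-square = +-cancelʳ-≡ (2 * W * A) (Z + 1) (Y * Y) (trans viaZ (sym viaY))
    where
    open ≡-Reasoning
    L : ℕ
    L = eval (m + m) low x
    expand : ∀ x xm C Q L T A′ → x * (L + xm * xm * (C * C * Q) * T) + 1 + 2 * (x * xm * (Q * C)) * (A′ + C * xm)
               ≡ (1 + x * ((2 * (Q * C) * xm * A′) + L)) + x * xm * xm * (C * C * Q) * (T + 2)
    expand = solve-∀
    W² : ∀ x xm C Q → x * xm * xm * (C * C * Q) * (Q * x) ≡ (x * xm * (Q * C)) * (x * xm * (Q * C))
    W² = solve-∀
    complete : ∀ y a → y * y + 2 * (y + a) * a ≡ (y + a) * (y + a) + a * a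
    complete = solve-∀
    viaZ : Z + 1 + 2 * W * A ≡ A * A + W * W
    viaZ = begin
      Z + 1 + 2 * W * A
        ≡⟨ cong₂ (λ w a → Z + 1 + 2 * w * a) W-form A-top ⟩
      Z + 1 + 2 * (x * x ^ m * (Q * Q ^ c)) * (A′ + Q ^ c * x ^ m)
        ≡⟨ expand x (x ^ m) (Q ^ c) Q L T A′ ⟩
      (1 + x * ((2 * (Q * Q ^ c) * x ^ m * A′) + L)) + x * x ^ m * x ^ m * (Q ^ c * Q ^ c * Q) * (T + 2)
        ≡⟨ cong₂ (λ e t → (1 + x * (e + L)) + x * x ^ m * x ^ m * (Q ^ c * Q ^ c * Q) * t) (sym eval-cross) T+2 ⟩
      (1 + x * (eval (m + m) cross x + L)) + x * x ^ m * x ^ m * (Q ^ c * Q ^ c * Q) * (Q * x)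
        ≡⟨ cong₂ _+_ (trans (cong (λ z → 1 + x * z) (sym square-split)) (sym A-square)) (W² x (x ^ m) (Q ^ c) Q) ⟩
      A * A + (x * x ^ m * (Q * Q ^ c)) * (x * x ^ m * (Q * Q ^ c))
        ≡⟨ cong (λ w → A * A + w * w) (sym W-form) ⟩
      A * A + W * W ∎
    viaY : Y * Y + 2 * W * A ≡ A * A + W * W
    viaY = begin
      Y * Y + 2 * W * A            ≡⟨ cong (λ w → Y * Y + 2 * w * A) (sym Y+A) ⟩
      Y * Y + 2 * (Y + A) * A      ≡⟨ complete Y A ⟩
      (Y + A) * (Y + A) + A * A    ≡⟨ cong (λ w → w * w + A * A) Y+A ⟩
      W * W + A * A                ≡⟨ +-comm (W * W) (A * A) ⟩
      A * A + W * W ∎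

  -- For 2c ≤ k the low coefficients have at most k digits, so the digit sum of Z
  -- is the sum of the digit sums of the low coefficients and of T.
  digitSum-Z : c + c ≤ k → digitSum Z ≡ lowDigitSum + digitSum T
  digitSum-Z 2c≤k = begin
    digitSum (x * S)                                   ≡⟨ cong digitSum (*-comm x S) ⟩
    digitSum (S * Q ^ k)                               ≡⟨ digitSum-shift k S ⟩
    digitSum S                                         ≡⟨ cong digitSum S≡ ⟩
    digitSum (T * Q ^ (c + c + 1) * Q ^ (k * (m + m)) + L)
      ≡⟨ digitSum-concat (k * (m + m)) (T * Q ^ (c + c + 1)) L (subst (L <_) (^-*-assoc Q k (m + m)) (eval< (m + m) low x low<x)) ⟩
    digitSum (T * Q ^ (c + c + 1)) + digitSum L        ≡⟨ cong₂ _+_ (digitSum-shift (c + c + 1) T) (digitSum-eval k (m + m) low low<x) ⟩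
    digitSum T + lowDigitSum                           ≡⟨ +-comm (digitSum T) lowDigitSum ⟩
    lowDigitSum + digitSum T ∎
    where
    open ≡-Reasoning
    L : ℕ
    L = eval (m + m) low x
    S : ℕ
    S = L + x ^ m * x ^ m * (Q ^ c * Q ^ c * Q) * T
    low<x : ∀ t → t < m + m → low t < x
    low<x t t<2m = <-≤-trans (low< t t<2m) (subst (_≤ x) (^-distribˡ-+-* Q c c) (^-monoʳ-≤ Q 2c≤k))
    reorder : ∀ a b c → a * b * c ≡ (c * b) * a
    reorder = solve-∀
    S≡ : S ≡ T * Q ^ (c + c + 1) * Q ^ (k * (m + m)) + L
    S≡ = begin
      L + x ^ m * x ^ m * (Q ^ c * Q ^ c * Q) * T       ≡⟨ +-comm L _ ⟩
      x ^ m * x ^ m * (Q ^ c * Q ^ c * Q) * T + L       ≡⟨ cong (_+ L) (reorder (x ^ m * x ^ m) (Q ^ c * Q ^ c * Q) T) ⟩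
      T * (Q ^ c * Q ^ c * Q) * (x ^ m * x ^ m) + L     ≡⟨ cong₂ (λ a b → T * a * b + L) (sym 2c+1) 2m ⟩
      T * Q ^ (c + c + 1) * Q ^ (k * (m + m)) + L ∎
      where
      2c+1 : Q ^ (c + c + 1) ≡ Q ^ c * Q ^ c * Q
      2c+1 = trans (^-distribˡ-+-* Q (c + c) 1) (cong₂ _*_ (^-distribˡ-+-* Q c c) (*-identityʳ Q))
      2m : x ^ m * x ^ m ≡ Q ^ (k * (m + m))
      2m = trans (sym (^-distribˡ-+-* x m m)) (^-*-assoc Q k (m + m))

-- The number u itself: its digits are blocks (Q-1) (Q-2) k m followed by (Q-1)^(n),
-- so u + 1 = Y · N with N = Q^n.  Squaring, u² = (Z · N + G) · N + 1 where
-- G = N - 2Y has the explicit digits (Q-1)^(n′) (Q-2) (digits of 2A); here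
-- n = n′ + 1 + blocksLength k m.
module Power (b m₀ k n′ : ℕ) where

  open import Defs using (u)
  open import Data.Nat
  open import Data.Nat.Properties
  open import Data.Nat.Tactic.RingSolver using (solve-∀)
  open import Data.List using (List; []; _∷_; _++_; replicate; length)
  open import Data.List.Properties using (length-replicate)
  open import Data.Nat.ListAction using (sum)
  open import Data.Nat.ListAction.Properties using (sum-++)
  open import Data.List.Relation.Unary.All using (_∷_)
  import Data.List.Relation.Unary.All.Properties as All
  open import Relation.Binary.PropositionalEquality
  open Digits b
  open BlockStrings b
  open Coefficients b m₀
  open Square b m₀ k

  n : ℕ
  n = n′ + suc (blocksLength k m)

  N : ℕ
  N = Q ^ n

  U : ℕ
  U = value (blocks (suc b) b k m ++ replicate n (suc b))

  u≡U : u Q m k n ≡ U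
  u≡U = cong value (uDigits-blocks m k n)

  U+1 : U + 1 ≡ Y * N
  U+1 = begin
    U + 1                                   ≡⟨ cong (_+ 1) (value-++ (blocks (suc b) b k m) (replicate n (suc b))) ⟩
    X * Q ^ length (replicate n (suc b)) + value (replicate n (suc b)) + 1
                                            ≡⟨ cong (λ l → X * Q ^ l + value (replicate n (suc b)) + 1) (length-replicate n) ⟩
    X * N + value (replicate n (suc b)) + 1 ≡⟨ +-assoc (X * N) _ 1 ⟩
    X * N + (value (replicate n (suc b)) + 1) ≡⟨ cong (X * N +_) (value-maxDigits n) ⟩
    X * N + N                               ≡⟨ +-comm (X * N) N ⟩
    Y * N ∎
    where
    open ≡-Reasoning
    X : ℕ
    X = value (blocks (suc b) b k m)

  tailDigits : List ℕ
  tailDigits = replicate n′ (suc b) ++ (b ∷ blocks 0 2 k m)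

  G : ℕ
  G = value tailDigits

  G+2Y : G + 2 * Y ≡ N
  G+2Y = begin
    value tailDigits + 2 * Y
      ≡⟨ cong (_+ 2 * Y) (value-++ (replicate n′ (suc b)) (b ∷ blocks 0 2 k m)) ⟩
    M * Q ^ length (b ∷ blocks 0 2 k m) + value (b ∷ blocks 0 2 k m) + 2 * Y
      ≡⟨ cong₂ (λ l v → M * Q ^ l + v + 2 * Y) (cong suc (blocks-length 0 2 k m)) twos ⟩
    M * (Q * W) + (b * W + 2 * A) + 2 * Y  ≡⟨ regroup₁ M b W A Y ⟩
    M * (Q * W) + b * W + 2 * (Y + A)      ≡⟨ cong (λ z → M * (Q * W) + b * W + 2 * z) Y+A ⟩
    M * (Q * W) + b * W + 2 * W            ≡⟨ regroup₂ M b W ⟩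
    (M + 1) * (Q * W)                      ≡⟨ cong (_* (Q * W)) (value-maxDigits n′) ⟩
    Q ^ n′ * (Q * W)                       ≡⟨ sym (^-distribˡ-+-* Q n′ (suc (blocksLength k m))) ⟩
    N ∎
    where
    open ≡-Reasoning
    M : ℕ
    M = value (replicate n′ (suc b))
    twos : value (b ∷ blocks 0 2 k m) ≡ b * W + 2 * A
    twos = trans (value-∷ b (blocks 0 2 k m))
      (cong₂ (λ l v → b * Q ^ l + v) (blocks-length 0 2 k m) (value-scale 2 (blocks⁺ {R = λ d d′ → d ≡ 2 * d′} refl refl k m)))
    regroup₁ : ∀ w b W A Y → w * ((2 + b) * W) + (b * W + 2 * A) + 2 * Y ≡ w * ((2 + b) * W) + b * W + 2 * (Y + A)
    regroup₁ = solve-∀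
    regroup₂ : ∀ w b W → w * ((2 + b) * W) + b * W + 2 * W ≡ (w + 1) * ((2 + b) * W)
    regroup₂ = solve-∀

  G<N : G < N
  G<N = subst (G <_) G+2Y (m<m+n G (*-mono-≤ {1} {2} {1} {Y} (s≤s z≤n) (s≤s z≤n)))

  U-square : U * U ≡ (Z * N + G) * N + 1
  U-square = +-cancelʳ-≡ (2 * (Y * N)) (U * U) ((Z * N + G) * N + 1) (trans viaU (sym viaZ))
    where
    open ≡-Reasoning
    complete : ∀ u → u * u + 2 * (u + 1) ≡ (u + 1) * (u + 1) + 1
    complete = solve-∀
    regroup₁ : ∀ z g y n → (z * n + g) * n + 1 + 2 * (y * n) ≡ z * n * n + (g + 2 * y) * n + 1
    regroup₁ = solve-∀
    regroup₂ : ∀ z n → z * n * n + n * n + 1 ≡ (z + 1) * n * n + 1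
    regroup₂ = solve-∀
    regroup₃ : ∀ y n → y * y * n * n + 1 ≡ (y * n) * (y * n) + 1
    regroup₃ = solve-∀
    viaU : U * U + 2 * (Y * N) ≡ (Y * N) * (Y * N) + 1
    viaU = trans (cong (λ z → U * U + 2 * z) (sym U+1)) (trans (complete U) (cong (λ z → z * z + 1) U+1))
    viaZ : (Z * N + G) * N + 1 + 2 * (Y * N) ≡ (Y * N) * (Y * N) + 1
    viaZ = begin
      (Z * N + G) * N + 1 + 2 * (Y * N)  ≡⟨ regroup₁ Z G Y N ⟩
      Z * N * N + (G + 2 * Y) * N + 1    ≡⟨ cong (λ z → Z * N * N + z * N + 1) G+2Y ⟩
      Z * N * N + N * N + 1              ≡⟨ regroup₂ Z N ⟩
      (Z + 1) * N * N + 1                ≡⟨ cong (λ z → z * N * N + 1) Y-square ⟩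
      Y * Y * N * N + 1                  ≡⟨ regroup₃ Y N ⟩
      (Y * N) * (Y * N) + 1 ∎

  -- The digits 2 of 2A are genuine digits only for Q ≥ 3.
  digitSum-G : 2 < Q → digitSum G ≡ n′ * suc b + (b + 2 * suc m)
  digitSum-G 2<Q = begin
    digitSum G
      ≡⟨ digitSum-value tailDigits (All.++⁺ (All.replicate⁺ n′ Q-1<Q) (Q-2<Q ∷ blocks-all (s≤s z≤n) 2<Q k m)) ⟩
    sum tailDigits
      ≡⟨ sum-++ (replicate n′ (suc b)) (b ∷ blocks 0 2 k m) ⟩
    sum (replicate n′ (suc b)) + (b + sum (blocks 0 2 k m))
      ≡⟨ cong₂ (λ a s → a + (b + s)) (sum-replicate n′ (suc b)) (trans (sym (+-identityʳ _)) (blocks-sum 0 2 k m)) ⟩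
    n′ * suc b + (b + 2 * suc m) ∎
    where open ≡-Reasoning

  -- The three parts Z, G and 1 of u² occupy disjoint digit ranges.
  digitSum-U² : 2 < Q → c + c ≤ k →
    digitSum (U * U) ≡ lowDigitSum + (k * suc b + b) + (n′ * suc b + (b + 2 * suc m)) + 1
  digitSum-U² 2<Q 2c≤k = begin
    digitSum (U * U)                       ≡⟨ cong digitSum U-square ⟩
    digitSum ((Z * N + G) * N + 1)         ≡⟨ digitSum-concat n (Z * N + G) 1 1<N ⟩
    digitSum (Z * N + G) + digitSum 1      ≡⟨ cong (_+ digitSum 1) (digitSum-concat n Z G G<N) ⟩
    digitSum Z + digitSum G + 1            ≡⟨ cong₂ (λ z g → z + g + 1) (trans (digitSum-Z 2c≤k) (cong (lowDigitSum +_) digitSum-T)) (digitSum-G 2<Q) ⟩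
    lowDigitSum + (k * suc b + b) + (n′ * suc b + (b + 2 * suc m)) + 1 ∎
    where
    open ≡-Reasoning
    1<N : 1 < N
    1<N = <-≤-trans (s≤s (s≤s z≤n)) (subst (_≤ N) (*-identityʳ Q) (^-monoʳ-≤ Q {1} {n} (subst (1 ≤_) (sym (+-suc n′ _)) (s≤s z≤n))))

  digitSum-U : digitSum U ≡ sum (blocks (suc b) b k m) + n * suc b
  digitSum-U = trans (digitSum-value _ (All.++⁺ (blocks-all Q-1<Q Q-2<Q k m) (All.replicate⁺ n Q-1<Q)))
    (trans (sum-++ (blocks (suc b) b k m) (replicate n (suc b))) (cong (sum (blocks (suc b) b k m) +_) (sum-replicate n (suc b))))

module IntegerForm where

  open import Data.Nat using (ℕ; _+_; _*_)
  open import Data.Integer using (+_; _-_) renaming (_+_ to _+ℤ_; _*_ to _*ℤ_)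
  open import Data.Integer.Properties using (pos-+; pos-*)
  open import Data.Integer.Tactic.RingSolver using (solve-∀)
  open import Relation.Binary.PropositionalEquality
  open ≡-Reasoning

  affine-diff : ∀ (a p B C E N : ℕ) → a + p * B + C ≡ E + p * N → + a ≡ + p *ℤ (+ N - + B) +ℤ (+ E - + C)
  affine-diff a p B C E N eq = begin
    + a                                         ≡⟨ cancel (+ a) (+ p *ℤ + B) (+ C) ⟩
    + a +ℤ + p *ℤ + B +ℤ + C - + p *ℤ + B - + C ≡⟨ cong (λ z → z - + p *ℤ + B - + C) lifted ⟩
    + E +ℤ + p *ℤ + N - + p *ℤ + B - + C        ≡⟨ collect (+ E) (+ p) (+ N) (+ B) (+ C) ⟩
    + p *ℤ (+ N - + B) +ℤ (+ E - + C)           ∎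
    where
    cancel : ∀ a pb c → a ≡ a +ℤ pb +ℤ c - pb - c
    cancel = solve-∀
    collect : ∀ e p n b c → e +ℤ p *ℤ n - p *ℤ b - c ≡ p *ℤ (n - b) +ℤ (e - c)
    collect = solve-∀
    lifted : + a +ℤ + p *ℤ + B +ℤ + C ≡ + E +ℤ + p *ℤ + N
    lifted = begin
      + a +ℤ + p *ℤ + B +ℤ + C  ≡⟨ cong (λ z → + a +ℤ z +ℤ + C) (sym (pos-* p B)) ⟩
      + a +ℤ + (p * B) +ℤ + C   ≡⟨ cong (_+ℤ + C) (sym (pos-+ a (p * B))) ⟩
      + (a + p * B) +ℤ + C      ≡⟨ sym (pos-+ (a + p * B) C) ⟩
      + (a + p * B + C)         ≡⟨ cong +_ eq ⟩
      + (E + p * N)             ≡⟨ pos-+ E (p * N) ⟩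
      + E +ℤ + (p * N)          ≡⟨ cong (+ E +ℤ_) (pos-* p N) ⟩
      + E +ℤ + p *ℤ + N         ∎

  affine : ∀ (a p B C E : ℕ) → a + C ≡ E + p * B → + a ≡ + p *ℤ + B +ℤ (+ E - + C)
  affine a p B C E eq = begin
    + a                         ≡⟨ cancel (+ a) (+ C) ⟩
    + a +ℤ + C - + C            ≡⟨ cong (_- + C) lifted ⟩
    + E +ℤ + p *ℤ + B - + C     ≡⟨ collect (+ E) (+ p) (+ B) (+ C) ⟩
    + p *ℤ + B +ℤ (+ E - + C)   ∎
    where
    cancel : ∀ a c → a ≡ a +ℤ c - c
    cancel = solve-∀
    collect : ∀ e p b c → e +ℤ p *ℤ b - c ≡ p *ℤ b +ℤ (e - c)
    collect = solve-∀
    lifted : + a +ℤ + C ≡ + E +ℤ + p *ℤ + B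
    lifted = trans (sym (pos-+ a C)) (trans (cong +_ eq) (trans (pos-+ E (p * B)) (cong (+ E +ℤ_) (pos-* p B))))

-- The constants of Theorem 3.1 for q = r + 3 and m = m₀ + 1, and the theorem for
-- n of the form n′ + 1 + blocksLength k m.
module Constants (r m₀ : ℕ) where

  open import Defs using (s; u)
  open import Data.Nat
  open import Data.Nat.Properties
  open import Data.Nat.Tactic.RingSolver using (solve-∀)
  open import Data.Integer using (ℤ; +_; _-_) renaming (_+_ to _+ℤ_; _*_ to _*ℤ_)
  open import Data.Product using (_×_; _,_)
  open import Data.Nat.ListAction using (sum)
  open import Relation.Binary.PropositionalEquality
  open Offsets using (offset-last; offset≤)
  open Digits (suc r) using (Q; digitSum)
  open BlockStrings (suc r) using (blocks; blocksLength; blocks-sum)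
  open Coefficients (suc r) m₀ using (m; c; lowDigitSum)
  open IntegerForm

  -- p = q - 1.
  p : ℕ
  p = suc (suc r)

  d : ℕ
  d = suc (suc c)

  e₁ : ℤ
  e₁ = + (lowDigitSum + 2 * suc r + 2 * suc m + 1) - + (p * (2 + c))

  e₂ : ℤ
  e₂ = + (p * suc c + suc r * suc m) - + (p * suc m)

  Conclusion : ℕ → ℕ → Set
  Conclusion k n = (+ s Q (u Q m k n * u Q m k n) ≡ (+ p) *ℤ (+ n - + (m * k)) +ℤ e₁)
                 × (+ s Q (u Q m k n) ≡ (+ p) *ℤ (+ (k * (m + 1) + n)) +ℤ e₂)

  -- The hypothesis on k gives 2c ≤ k, since every gap is at most m + 1.
  2c≤k : ∀ k → 2 * m * (m + 1) ∸ 1 < k → c + c ≤ k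
  2c≤k k k-large = ≤-trans (subst (c + c ≤_) (twice m) (+-mono-≤ (offset≤ m m) (offset≤ m m))) k-large
    where
    twice : ∀ m → m * suc m + m * suc m ≡ 2 * m * (m + 1)
    twice = solve-∀

  -- The hypothesis on n says that n exceeds 1 + blocksLength k m = (m + 1) k + d.
  n-split : ∀ k n → (m + 1) * k + d < n → n ∸ suc (blocksLength k m) + suc (blocksLength k m) ≡ n
  n-split k n n-large = m∸n+n≡m (<⇒≤ (subst (_< n) (sym L+1) n-large))
    where
    regroup : ∀ m k c → suc (suc m * k + suc c) ≡ (m + 1) * k + suc (suc c)
    regroup = solve-∀
    L+1 : suc (blocksLength k m) ≡ (m + 1) * k + d
    L+1 = trans (cong (λ e → suc (suc m * k + e)) (offset-last m)) (regroup m k c)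

  module _ (k n′ : ℕ) where
    open Power (suc r) m₀ k n′
    open ≡-Reasoning

    digitSum-square : c + c ≤ k → + digitSum (U * U) ≡ + p *ℤ (+ n - + (m * k)) +ℤ e₁
    digitSum-square 2c≤k = affine-diff (digitSum (U * U)) p (m * k) (p * (2 + c)) E₁ n (begin
      digitSum (U * U) + p * (m * k) + p * (2 + c)
        ≡⟨ cong (λ z → z + p * (m * k) + p * (2 + c)) (digitSum-U² (s≤s (s≤s (s≤s z≤n))) 2c≤k) ⟩
      lowDigitSum + (k * p + suc r) + (n′ * p + (suc r + 2 * suc m)) + 1 + p * (m * k) + p * (2 + c)
        ≡⟨ regroup lowDigitSum k p r n′ m c ⟩
      E₁ + p * (n′ + suc (suc m * k + suc c))
        ≡⟨ cong (λ e → E₁ + p * (n′ + suc (suc m * k + e))) (sym (offset-last m)) ⟩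
      E₁ + p * n ∎)
      where
      E₁ : ℕ
      E₁ = lowDigitSum + 2 * suc r + 2 * suc m + 1
      regroup : ∀ S k p r n′ m c → S + (k * p + suc r) + (n′ * p + (suc r + 2 * suc m)) + 1 + p * (m * k) + p * (2 + c)
                  ≡ S + 2 * suc r + 2 * suc m + 1 + p * (n′ + suc (suc m * k + suc c))
      regroup = solve-∀

    digitSum-plain : + digitSum U ≡ + p *ℤ + (k * (m + 1) + n) +ℤ e₂
    digitSum-plain = affine (digitSum U) p (k * (m + 1) + n) (p * suc m) (p * suc c + suc r * suc m) (begin
      digitSum U + p * suc m                              ≡⟨ cong (_+ p * suc m) digitSum-U ⟩
      S + n * p + p * suc m                               ≡⟨ regroup₁ S n p (suc m) ⟩
      S + p * suc m + n * p                               ≡⟨ cong (_+ n * p) (blocks-sum p (suc r) k m) ⟩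
      p * blocksLength k m + suc r * suc m + n * p        ≡⟨ cong (λ e → p * (suc m * k + e) + suc r * suc m + n * p) (offset-last m) ⟩
      p * (suc m * k + suc c) + suc r * suc m + n * p     ≡⟨ regroup₂ p m k c r n ⟩
      p * suc c + suc r * suc m + p * (k * (m + 1) + n)   ∎)
      where
      S : ℕ
      S = sum (blocks p (suc r) k m)
      regroup₁ : ∀ S n p m → S + n * p + p * m ≡ S + p * m + n * p
      regroup₁ = solve-∀
      regroup₂ : ∀ p m k c r n → p * (suc m * k + suc c) + suc r * suc m + n * p ≡ p * suc c + suc r * suc m + p * (k * (m + 1) + n)
      regroup₂ = solve-∀

  conclusion : ∀ k n′ → c + c ≤ k → Conclusion k (n′ + suc (blocksLength k m))
  conclusion k n′ 2c≤k rewrite Power.u≡U (suc r) m₀ k n′ = digitSum-square k n′ 2c≤k , digitSum-plain k n′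

open import Defs using (s; u)
open import Data.Nat using (suc; _+_; _*_; _∸_; _≤_; _<_; z≤n; s≤s)
open import Data.Integer using (ℤ; +_; _-_) renaming (_+_ to _+ℤ_; _*_ to _*ℤ_)
open import Data.Product using (Σ; _×_; _,_)
open import Relation.Binary.PropositionalEquality using (_≡_; subst)

theorem3p1 : (q : ℕ) → 3 ≤ q → (m : ℕ) → 1 ≤ m →
    Σ ℕ λ d → 0 < d × Σ ℤ λ e₁ → Σ ℤ λ e₂ →
      (k n : ℕ) → 1 ≤ k → 1 ≤ n → 2 * m * (m + 1) ∸ 1 < k → (m + 1) * k + d < n →
        (+ s q (u q m k n * u q m k n) ≡ (+ (q ∸ 1)) *ℤ (+ n - + (m * k)) +ℤ e₁)
        × (+ s q (u q m k n) ≡ (+ (q ∸ 1)) *ℤ (+ (k * (m + 1) + n)) +ℤ e₂)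
theorem3p1 (suc (suc (suc r))) (s≤s (s≤s (s≤s z≤n))) (suc m₀) (s≤s z≤n) =
  d , s≤s z≤n , e₁ , e₂ , λ k n _ _ k-large n-large →
    subst (Conclusion k) (n-split k n n-large)
      (conclusion k (n ∸ suc (blocksLength k (suc m₀))) (2c≤k k k-large))
  where
  open Constants r m₀
  open BlockStrings (suc r) using (blocksLength)
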